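{- For every finite simple graph $H$ and every integer $r\geq 2$, the compatibility graph $C_{\mathrm{Hom}_p(\mathcal{K}_r, H)}$ is $\mathcal{K}_{r+1}$-free, i.e. it contains no clique on $r+1$ vertices.
   Context: All graphs are finite, simple and undirected; $\mathcal{K}_r$ denotes the complete graph on vertex set $\{1,\dots,r\}$. For a graph $H$, the Hom poset $\mathrm{Hom}_p(\mathcal{K}_r,H)$ is the set of all $r$-tuples $(A_1,\dots,A_r)$ of non-empty subsets of $V(H)$ such that for every pair $i\neq j$ in $\{1,\dots,r\}$ every vertex of $A_i$ is adjacent in $H$ to every vertex of $A_j$ (i.e. $A_i\times A_j\subseteq E(H)$), ordered by $(A_1,\dots,A_r)\leq(B_1,\dots,B_r)$ iff $A_i\subseteq B_i$ for all $i$. The cyclic group $Z_r=\{e=\omega^0,\omega,\dots,\omega^{r-1}\}$ acts on it by cyclic shift: $\omega^i.(A_1,\dots,A_r)=(A_{1+i},\dots,A_{r+i})$, indices taken modulo $r$ in $\{1,\dots,r\}$. For a poset $P$ with an order-preserving action of a finite group $G$, the compatibility graph $C_P$ has vertex set $P$, with $x,y$ adjacent iff there is $g\in G\setminus\{e\}$ such that $x$ and $g.y$ are comparable in $P$. A graph is $\mathcal{K}_{r+1}$-free if no induced subgraph is isomorphic to $\mathcal{K}_{r+1}$. -}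

module Defs where

open import Data.Nat using (ℕ; suc; _+_; _%_)
open import Data.Nat.DivMod using (_mod_)
open import Data.Fin using (Fin; toℕ; zero)
open import Data.Fin.Subset using (Subset; _∈_; _⊆_; Nonempty)
open import Data.Bool using (Bool; true; false)
open import Data.Product using (Σ; _×_; ∃; _,_)
open import Data.Sum using (_⊎_)
open import Relation.Binary.PropositionalEquality using (_≡_; _≢_)
open import Relation.Nullary using (¬_)

record Graph : Set where
  field
    n     : ℕ
    adj   : Fin n → Fin n → Bool
    sym   : ∀ x y → adj x y ≡ adj y x
    irrefl : ∀ x → adj x x ≡ false
open Graph public

Adj : (H : Graph) → Fin (n H) → Fin (n H) → Set
Adj H x y = adj H x y ≡ true

-- r-tuples of subsets of V(H), indexed by Fin r (index i stands for i+1).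
Tuple : ℕ → Graph → Set
Tuple r H = Fin r → Subset (n H)

IsHom : (r : ℕ) (H : Graph) → Tuple r H → Set
IsHom r H A =
  (∀ i → Nonempty (A i)) ×
  (∀ i j → i ≢ j → ∀ x y → x ∈ A i → y ∈ A j → Adj H x y)

HomP : ℕ → Graph → Set
HomP r H = Σ (Tuple r H) (IsHom r H)

_≤P_ : {r : ℕ} {H : Graph} → Tuple r H → Tuple r H → Set
A ≤P B = ∀ i → A i ⊆ B i

shiftIdx : {r : ℕ} → ℕ → Fin r → Fin r
shiftIdx {suc m} k i = (toℕ i + k) mod suc m

-- action of ω^k : (ω^k . A)_i = A_{i+k}
act : {r : ℕ} {H : Graph} → Fin r → Tuple r H → Tuple r H
act k A i = A (shiftIdx (toℕ k) i)

-- edges of the compatibility graph C_P (g = ω^k with k ≠ 0, i.e. g ≠ e)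
Compatible : {r : ℕ} {H : Graph} → HomP r H → HomP r H → Set
Compatible {r} {H} (A , _) (B , _) =
  ∃ λ (k : Fin r) → (toℕ k ≢ 0) × ((_≤P_ {r} {H} A (act {r} {H} k B)) ⊎ (_≤P_ {r} {H} (act {r} {H} k B) A))

SameElem : {r : ℕ} {H : Graph} → HomP r H → HomP r H → Set
SameElem (A , _) (B , _) = ∀ i → A i ≡ B i

HasClique : (r : ℕ) (H : Graph) (m : ℕ) → Set
HasClique r H m =
  Σ (Fin m → HomP r H) λ f →
    (∀ a b → a ≢ b → ¬ SameElem {r} {H} (f a) (f b)) ×
    (∀ a b → a ≢ b → Compatible {r} {H} (f a) (f b))

-- The components of an element of Hom_p(K_r, H) are pairwise disjoint because H has no loops;
-- hence if X is compatible with Y via ω^h then X_i ∩ Y_i = ∅ for every i.  Now suppose A is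
-- compatible with both B and C via the same ω^k, and B with C via some ω^h ≠ e.  Either ω^k.B and
-- ω^k.C share a vertex in some component, contradicting the above, or both lie below A, and then a
-- vertex of B_j ∩ C_{j+h} lies in the two distinct components A_{j-k} and A_{j+h-k}.  So the r
-- neighbours of a vertex in an (r+1)-clique would need r distinct shifts among the r - 1
-- non-trivial ones.
module Submission where

open import Defs hiding (sym)
open import Data.Nat using (ℕ; zero; suc; _+_; _*_; _∸_; _%_; _≤_; _<_; NonZero)
open import Data.Nat.Properties
  using (+-assoc; +-cancelˡ-≡; m≤m+n; <⇒≤; m∸n+n≡m; <-irrefl; <-≤-trans; n<1+n)
open import Data.Nat.DivMod
  using (m%n<n; m%n%n≡m%n; %-distribˡ-+; [m+n]%n≡m%n; m<n⇒m%n≡m; m≡m%n+[m/n]*n; _/_)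
import Data.Fin as Fin
open import Data.Fin using (Fin; toℕ) renaming (zero to fz; suc to fs)
open import Data.Fin.Properties using (toℕ-injective; toℕ-fromℕ<; toℕ<n; pigeonhole; <⇒≢; suc-injective)
open import Data.Fin.Subset using (_∈_; Nonempty)
open import Data.Product using (Σ; ∃; ∃₂; _×_; _,_; proj₁; proj₂)
open import Data.Sum using (_⊎_; inj₁; inj₂)
open import Data.Empty using (⊥; ⊥-elim)
open import Relation.Binary.PropositionalEquality using (_≡_; _≢_; refl; sym; trans; cong; subst; module ≡-Reasoning)
open import Relation.Nullary using (¬_)
open import Function using (_∘_)

[m%n+o]%n≡[m+o]%n : ∀ m o n .{{_ : NonZero n}} → (m % n + o) % n ≡ (m + o) % n
[m%n+o]%n≡[m+o]%n m o n = begin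
  (m % n + o) % n           ≡⟨ %-distribˡ-+ (m % n) o n ⟩
  (m % n % n + o % n) % n   ≡⟨ cong (λ z → (z + o % n) % n) (m%n%n≡m%n m n) ⟩
  (m % n + o % n) % n       ≡⟨ sym (%-distribˡ-+ m o n) ⟩
  (m + o) % n               ∎
  where open ≡-Reasoning

toℕ-shiftIdx : ∀ {m} k (i : Fin (suc m)) → toℕ (shiftIdx k i) ≡ (toℕ i + k) % suc m
toℕ-shiftIdx {m} k i = toℕ-fromℕ< (m%n<n (toℕ i + k) (suc m))

shiftIdx-surjective : ∀ {m} (k j : Fin (suc m)) → ∃ λ i → shiftIdx (toℕ k) i ≡ j
shiftIdx-surjective {m} k j = i , toℕ-injective shift-i≡j
  where
  N : ℕ
  N = suc m
  i : Fin N
  i = shiftIdx (N ∸ toℕ k) j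
  shift-i≡j : toℕ (shiftIdx (toℕ k) i) ≡ toℕ j
  shift-i≡j = begin
    toℕ (shiftIdx (toℕ k) i)                 ≡⟨ toℕ-shiftIdx (toℕ k) i ⟩
    (toℕ i + toℕ k) % N                      ≡⟨ cong (λ z → (z + toℕ k) % N) (toℕ-shiftIdx (N ∸ toℕ k) j) ⟩
    ((toℕ j + (N ∸ toℕ k)) % N + toℕ k) % N  ≡⟨ [m%n+o]%n≡[m+o]%n (toℕ j + (N ∸ toℕ k)) (toℕ k) N ⟩
    (toℕ j + (N ∸ toℕ k) + toℕ k) % N        ≡⟨ cong (_% N) (+-assoc (toℕ j) (N ∸ toℕ k) (toℕ k)) ⟩
    (toℕ j + (N ∸ toℕ k + toℕ k)) % N        ≡⟨ cong (λ z → (toℕ j + z) % N) (m∸n+n≡m (<⇒≤ (toℕ<n k))) ⟩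
    (toℕ j + N) % N                          ≡⟨ [m+n]%n≡m%n (toℕ j) N ⟩
    toℕ j % N                                ≡⟨ m<n⇒m%n≡m (toℕ<n j) ⟩
    toℕ j                                    ∎
    where open ≡-Reasoning

multiple<⇒≡0 : ∀ {a} q n → a ≡ q * n → a < n → a ≡ 0
multiple<⇒≡0 zero    n a≡0   _   = a≡0
multiple<⇒≡0 (suc q) n a≡n+qn a<n =
  ⊥-elim (<-irrefl refl (<-≤-trans a<n (subst (n ≤_) (sym a≡n+qn) (m≤m+n n (q * n)))))

-- A fixed point makes k a multiple of suc m.
shiftIdx-fixedPoint-free : ∀ {m} (k : Fin (suc m)) → toℕ k ≢ 0 → ∀ j → shiftIdx (toℕ k) j ≢ j
shiftIdx-fixedPoint-free {m} k k≢0 j fixed = k≢0 (multiple<⇒≡0 q N k≡q*N (toℕ<n k))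
  where
  N q : ℕ
  N = suc m
  q = (toℕ j + toℕ k) / N
  k≡q*N : toℕ k ≡ q * N
  k≡q*N = +-cancelˡ-≡ (toℕ j) (toℕ k) (q * N) (begin
    toℕ j + toℕ k                ≡⟨ m≡m%n+[m/n]*n (toℕ j + toℕ k) N ⟩
    (toℕ j + toℕ k) % N + q * N  ≡⟨ cong (_+ q * N) (trans (sym (toℕ-shiftIdx (toℕ k) j)) (cong toℕ fixed)) ⟩
    toℕ j + q * N                ∎)
    where open ≡-Reasoning

module _ (H : Graph) where

  components-disjoint : ∀ {r} {A : Tuple r H} → IsHom r H A →
                        ∀ {i j} → i ≢ j → ∀ {x} → x ∈ A i → x ∈ A j → ⊥
  components-disjoint (_ , adjacent) {i} {j} i≢j {x} x∈Ai x∈Aj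
    with trans (sym (adjacent i j i≢j x x x∈Ai x∈Aj)) (irrefl H x)
  ... | ()

  ShiftComparable : ∀ {r} → Tuple r H → Tuple r H → Fin r → Set
  ShiftComparable {r} A B k = _≤P_ {r} {H} A (act {r} {H} k B) ⊎ _≤P_ {r} {H} (act {r} {H} k B) A

  module _ {m : ℕ} where

    shiftComparable-meets : {A B : Tuple (suc m) H} {k : Fin (suc m)} →
                            (∀ i → Nonempty (A i)) → (∀ i → Nonempty (B i)) → ShiftComparable A B k →
                            ∀ i → ∃ λ x → x ∈ A i × x ∈ B (shiftIdx (toℕ k) i)
    shiftComparable-meets neA neB (inj₁ A≤kB) i with neA i
    ... | x , x∈A = x , x∈A , A≤kB i x∈A
    shiftComparable-meets {k = k} neA neB (inj₂ kB≤A) i with neB (shiftIdx (toℕ k) i)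
    ... | x , x∈B = x , kB≤A i x∈B , x∈B

    shiftComparable-disjoint : {A B : Tuple (suc m) H} {k : Fin (suc m)} →
                               IsHom (suc m) H A → IsHom (suc m) H B → toℕ k ≢ 0 → ShiftComparable A B k →
                               ∀ i {x} → x ∈ A i → x ∈ B i → ⊥
    shiftComparable-disjoint {k = k} homA homB k≢0 (inj₁ A≤kB) i x∈A x∈B =
      components-disjoint homB (shiftIdx-fixedPoint-free k k≢0 i) (A≤kB i x∈A) x∈B
    shiftComparable-disjoint {B = B} {k} homA homB k≢0 (inj₂ kB≤A) i x∈A x∈B
      with shiftIdx-surjective k i
    ... | j , kj≡i = components-disjoint homA j≢i (kB≤A j (subst (λ l → _ ∈ B l) (sym kj≡i) x∈B)) x∈A
      where
      j≢i : j ≢ i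
      j≢i j≡i = shiftIdx-fixedPoint-free k k≢0 j (trans kj≡i (sym j≡i))

    no-common-shift : {A B C : Tuple (suc m) H} {k h : Fin (suc m)} →
                      IsHom (suc m) H A → IsHom (suc m) H B → IsHom (suc m) H C → toℕ h ≢ 0 →
                      ShiftComparable A B k → ShiftComparable A C k → ShiftComparable B C h → ⊥
    no-common-shift homA homB homC h≢0 (inj₁ A≤kB) (inj₁ A≤kC) B~C with proj₁ homA fz
    ... | x , x∈A =
      shiftComparable-disjoint homB homC h≢0 B~C _ (A≤kB fz x∈A) (A≤kC fz x∈A)
    no-common-shift {k = k} homA homB homC h≢0 (inj₁ A≤kB) (inj₂ kC≤A) B~C
      with proj₁ homC (shiftIdx (toℕ k) fz)
    ... | x , x∈C =
      shiftComparable-disjoint homB homC h≢0 B~C _ (A≤kB fz (kC≤A fz x∈C)) x∈C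
    no-common-shift {k = k} homA homB homC h≢0 (inj₂ kB≤A) (inj₁ A≤kC) B~C
      with proj₁ homB (shiftIdx (toℕ k) fz)
    ... | x , x∈B =
      shiftComparable-disjoint homB homC h≢0 B~C _ x∈B (A≤kC fz (kB≤A fz x∈B))
    no-common-shift {C = C} {k} {h} homA homB homC h≢0 (inj₂ kB≤A) (inj₂ kC≤A) B~C
      with shiftComparable-meets (proj₁ homB) (proj₁ homC) B~C j
         | shiftIdx-surjective k (shiftIdx (toℕ h) j)
      where
      j : Fin (suc m)
      j = shiftIdx (toℕ k) fz
    ... | x , x∈Bj , x∈Chj | i , ki≡hj =
      components-disjoint homA i≢0 (kC≤A i (subst (λ l → x ∈ C l) (sym ki≡hj) x∈Chj)) (kB≤A fz x∈Bj)
      where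
      i≢0 : i ≢ fz
      i≢0 i≡0 = shiftIdx-fixedPoint-free h h≢0 _ (trans (sym ki≡hj) (cong (shiftIdx (toℕ k)) i≡0))

    compatible⇒nontrivialShift : {X Y : HomP (suc m) H} → Compatible {suc m} {H} X Y →
                                 Σ (Fin m) λ k → ShiftComparable (proj₁ X) (proj₁ Y) (fs k)
    compatible⇒nontrivialShift (fz   , 0≢0 , _)   = ⊥-elim (0≢0 refl)
    compatible⇒nontrivialShift (fs k , _   , X~Y) = k , X~Y

theorem3p1 : (H : Graph) (r : ℕ) → 2 ≤ r → ¬ HasClique r H (suc r)
theorem3p1 H (suc m) _ (f , _ , compatible) = twoEqualShifts (pigeonhole (n<1+n m) (proj₁ ∘ shiftFromFirst))
  where
  tuple : Fin (suc (suc m)) → Tuple (suc m) H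
  tuple a = proj₁ (f a)
  shiftFromFirst : ∀ a → Σ (Fin m) λ k → ShiftComparable H (tuple fz) (tuple (fs a)) (fs k)
  shiftFromFirst a = compatible⇒nontrivialShift H {X = f fz} {Y = f (fs a)} (compatible fz (fs a) λ ())
  twoEqualShifts : (∃₂ λ a b → a Fin.< b × proj₁ (shiftFromFirst a) ≡ proj₁ (shiftFromFirst b)) → ⊥
  twoEqualShifts (a , b , a<b , sameShift) with compatible (fs a) (fs b) (<⇒≢ a<b ∘ suc-injective)
  ... | h , h≢0 , B~C = no-common-shift H (proj₂ (f fz)) (proj₂ (f (fs a))) (proj₂ (f (fs b))) h≢0 A~B A~C B~C
    where
    A~B : ShiftComparable H (tuple fz) (tuple (fs a)) (fs (proj₁ (shiftFromFirst a)))
    A~B = proj₂ (shiftFromFirst a)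
    A~C : ShiftComparable H (tuple fz) (tuple (fs b)) (fs (proj₁ (shiftFromFirst a)))
    A~C = subst (λ k → ShiftComparable H (tuple fz) (tuple (fs b)) (fs k)) (sym sameShift) (proj₂ (shiftFromFirst b))
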